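{- Let $G$ be an edge-colored graph, $v\in V(G)$ and $x\in N(v)$. Put $Y=N(v)\setminus N_{c(vx)}(v)$. Then $rt(v,x)\geq \sigma_{v,Y}(x)$ and $$rt\big(v,N_{c(vx)}(v)\big)\geq \sum_{x'\in N_{c(vx)}(v)}\sigma_{v,Y}(x').$$
   Context: An edge-colored graph is a simple graph $G$ with edge coloring $c$. For a vertex $v$ and a color $\alpha$, $N_\alpha(v)=\{u\in N(v): c(uv)=\alpha\}$. For a vertex $y$ and a set $Z$ of vertices, $\mathcal{C}(y,Z)$ denotes the set of colors on edges $yz$ with $z\in Z\cap N(y)$. A triangle (or path) is rainbow if its edges have pairwise distinct colors. $rt(v,x)$ is the number of rainbow triangles containing the edge $vx$, and for $X\subseteq N(v)$, $rt(v,X)=\sum_{x\in X}rt(v,x)$. Restriction color: fix $v\in V(G)$ and $X\subseteq N(v)$, and let $y\in V(G)\setminus\{v\}$. A color $\alpha$ is restricted for $y$ by $(v,X)$ if there is $x\in X\cap N(y)$ with $c(xy)=\alpha$ such that the path $vxy$ is rainbow (i.e. $c(vx)\neq c(xy)$), and $\alpha\notin\mathcal{C}(y,N(y)\setminus X)$. $\sigma_{v,X}(y)$ denotes the number of colors restricted for $y$ by $(v,X)$. -}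

module Defs where

open import Data.Nat using (ℕ; zero; suc; _+_)
open import Data.Bool using (Bool; true; false; _∧_; not; if_then_else_)
open import Data.Fin using (Fin)
open import Data.Fin.Properties using () renaming (_≟_ to _≟ᶠ_)
open import Data.List using (List; length; filter; map)
open import Data.Nat.ListAction using (sum)
open import Data.Bool.ListAction using (any)
open import Data.List using () renaming (allFin to allFinL)
open import Relation.Nullary.Decidable using (⌊_⌋)
open import Relation.Binary.PropositionalEquality using (_≡_)

-- A finite simple edge-colored graph on vertex set Fin n with colors in Fin k.
-- adj is a symmetric irreflexive adjacency relation; col u w is the color of
-- the edge uw (its value on non-edges is irrelevant); col is symmetric.
record ECGraph (n k : ℕ) : Set where
  field
    adj      : Fin n → Fin n → Bool
    col      : Fin n → Fin n → Fin k
    adj-sym  : ∀ u w → adj u w ≡ adj w u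
    adj-irr  : ∀ u → adj u u ≡ false
    col-sym  : ∀ u w → col u w ≡ col w u

VSet : ℕ → Set
VSet n = Fin n → Bool

count : ∀ {n} → (Fin n → Bool) → ℕ
count {n} P = length (filter (λ i → Data.Bool.T? (P i)) (allFinL n))

sumOver : ∀ {n} → VSet n → (Fin n → ℕ) → ℕ
sumOver {n} X f = sum (map (λ i → if X i then f i else 0) (allFinL n))

_==ᶠ_ : ∀ {m} → Fin m → Fin m → Bool
a ==ᶠ b = ⌊ a ≟ᶠ b ⌋

module _ {n k : ℕ} (G : ECGraph n k) where
  open ECGraph G

  N : Fin n → VSet n
  N v u = adj v u

  Nc : Fin n → Fin k → VSet n
  Nc v α u = adj v u ∧ (col v u ==ᶠ α)

  -- rt(v,x): number of rainbow triangles containing the edge vx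
  -- (for x ∈ N(v); each triangle vxw is determined by its third vertex w)
  rt : Fin n → Fin n → ℕ
  rt v x = count (λ w → adj v w ∧ adj x w
                         ∧ not (col v x ==ᶠ col x w)
                         ∧ not (col v x ==ᶠ col v w)
                         ∧ not (col x w ==ᶠ col v w))

  rtSet : Fin n → VSet n → ℕ
  rtSet v X = sumOver X (rt v)

  inC : Fin n → VSet n → Fin k → Bool
  inC y Z α = any (λ z → Z z ∧ adj y z ∧ (col y z ==ᶠ α)) (allFinL n)

  restricted : Fin n → VSet n → Fin n → Fin k → Bool
  restricted v X y α =
    any (λ x → X x ∧ adj y x ∧ (col x y ==ᶠ α) ∧ not (col v x ==ᶠ col x y))
        (allFinL n)
    ∧ not (inC y (λ z → adj y z ∧ not (X z)) α)

  σ : Fin n → VSet n → Fin n → ℕ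
  σ v X y = count (restricted v X y)

-- A colour α restricted for x by (v, Y) is seen from x along an edge xw with
-- w ∈ Y, and it cannot be c(xv), since v ∈ N(x) ∖ Y.  When c(vx) = β and Y is
-- N(v) ∖ N_β(v), this makes vxw a rainbow triangle.  So every restricted colour
-- is c(xw) for the apex w of some rainbow triangle on vx, giving
-- σ_{v,Y}(x) ≤ rt(v,x); the second inequality sums this over N_β(v).
module Submission where

open import Defs
open import Data.Nat using (ℕ; _≤_; z≤n)
open import Data.Nat.Properties using (+-mono-≤; module ≤-Reasoning)
open import Data.Bool using (Bool; true; false; T; T?; _∧_; not; if_then_else_)
open import Data.Bool.Properties using (T-∧; T-≡)
open import Data.Fin using (Fin)
open import Data.Fin.Properties using (_≟_)
open import Data.List using (List; []; _∷_; length; filter; map; allFin)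
open import Data.List.Properties using (length-map; filter-notAll)
open import Data.Nat.ListAction using (sum)
open import Data.List.Membership.Propositional.Properties
  using (∈-allFin; ∈-filter⁺; ∈-filter⁻; ∈-map⁺)
open import Data.List.Relation.Binary.Subset.Propositional using (_⊆_)
open import Data.List.Relation.Unary.All as All using ()
open import Data.List.Relation.Unary.Any as Any using (Any; here; there; satisfied)
open import Data.List.Relation.Unary.Any.Properties using (any⁻; any⁺)
open import Data.List.Relation.Unary.AllPairs using ([]; _∷_)
open import Data.List.Relation.Unary.Unique.Propositional using (Unique)
open import Data.List.Relation.Unary.Unique.Propositional.Properties using (filter⁺; allFin⁺)
open import Data.Product using (_×_; _,_; proj₁; proj₂; ∃)
open import Function using (_∘_; Equivalence)
open import Relation.Binary.Definitions using (DecidableEquality)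
open import Relation.Binary.PropositionalEquality using (_≡_; _≢_; refl; sym; trans; subst)
open import Relation.Nullary using (¬_; ¬?; Dec)
open import Relation.Nullary.Decidable using (toWitness; fromWitness; toWitnessFalse; fromWitnessFalse)

∧-elim : ∀ a {b} → T (a ∧ b) → T a × T b
∧-elim _ = Equivalence.to T-∧

∧-intro : ∀ {a b} → T a → T b → T (a ∧ b)
∧-intro ta tb = Equivalence.from T-∧ (ta , tb)

T-not⇒¬T : ∀ {b} → T (not b) → ¬ T b
T-not⇒¬T {false} _ ()

¬T⇒T-not : ∀ {b} → ¬ T b → T (not b)
¬T⇒T-not {true}  ¬b = ¬b _
¬T⇒T-not {false} _  = _

≢⇒T-not-==ᶠ : ∀ {m} {a b : Fin m} → a ≢ b → T (not (a ==ᶠ b))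
≢⇒T-not-==ᶠ = fromWitnessFalse

unique-⊆⇒length-≤ : {A : Set} → DecidableEquality A → {xs ys : List A} →
                    Unique xs → xs ⊆ ys → length xs ≤ length ys
unique-⊆⇒length-≤ _≟ᴬ_ {[]} [] _ = z≤n
unique-⊆⇒length-≤ {A} _≟ᴬ_ {x ∷ xs} {ys} (x∉xs ∷ xs!) x∷xs⊆ys = begin-strict
  length xs                      ≤⟨ unique-⊆⇒length-≤ _≟ᴬ_ xs! xs⊆ys-without-x ⟩
  length (filter differs-x? ys)  <⟨ filter-notAll differs-x? ys x∈ys ⟩
  length ys                      ∎
  where
  open ≤-Reasoning
  differs-x? : (y : A) → Dec (x ≢ y)
  differs-x? y = ¬? (x ≟ᴬ y)
  x∈ys : Any (λ y → ¬ x ≢ y) ys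
  x∈ys = Any.map (λ x≡y x≢y → x≢y x≡y) (x∷xs⊆ys (here refl))
  xs⊆ys-without-x : xs ⊆ filter differs-x? ys
  xs⊆ys-without-x y∈xs = ∈-filter⁺ differs-x? (x∷xs⊆ys (there y∈xs)) (All.lookup x∉xs y∈xs)

count-≤-image : ∀ {m n} (P : Fin m → Bool) (Q : Fin n → Bool) (g : Fin n → Fin m) →
                (∀ a → T (P a) → ∃ λ w → T (Q w) × g w ≡ a) → count P ≤ count Q
count-≤-image {m} {n} P Q g cover = begin
  count P           ≤⟨ unique-⊆⇒length-≤ _≟_ (filter⁺ (T? ∘ P) {allFin m} (allFin⁺ m)) P⊆image ⟩
  length (map g Qs) ≡⟨ length-map g Qs ⟩
  count Q           ∎
  where
  open ≤-Reasoning
  Qs : List (Fin n)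
  Qs = filter (T? ∘ Q) (allFin n)
  P⊆image : filter (T? ∘ P) (allFin m) ⊆ map g Qs
  P⊆image a∈P with w , Qw , refl ← cover _ (proj₂ (∈-filter⁻ (T? ∘ P) {xs = allFin m} a∈P)) =
    ∈-map⁺ g (∈-filter⁺ (T? ∘ Q) (∈-allFin w) Qw)

sum-map-mono : ∀ {A : Set} {f g : A → ℕ} (xs : List A) →
               (∀ a → f a ≤ g a) → sum (map f xs) ≤ sum (map g xs)
sum-map-mono []       f≤g = z≤n
sum-map-mono (x ∷ xs) f≤g = +-mono-≤ (f≤g x) (sum-map-mono xs f≤g)

sumOver-mono : ∀ {n} (X : VSet n) {f g : Fin n → ℕ} →
               (∀ i → T (X i) → f i ≤ g i) → sumOver X f ≤ sumOver X g
sumOver-mono {n} X f≤g = sum-map-mono (allFin n) (λ i → if-mono (X i) (f≤g i))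
  where
  if-mono : ∀ b {p q} → (T b → p ≤ q) → (if b then p else 0) ≤ (if b then q else 0)
  if-mono true  p≤q = p≤q _
  if-mono false _   = z≤n

module _ {n k : ℕ} (G : ECGraph n k) where
  open ECGraph G

  N∖Nc : Fin n → Fin k → VSet n
  N∖Nc v β w = adj v w ∧ not (col v w ==ᶠ β)

  isRainbowApex : Fin n → Fin n → Fin n → Bool
  isRainbowApex v x w = adj v w ∧ adj x w
                        ∧ not (col v x ==ᶠ col x w)
                        ∧ not (col v x ==ᶠ col v w)
                        ∧ not (col x w ==ᶠ col v w)

  rainbowApex-intro : ∀ {v x w} → T (adj v w) → T (adj x w) →
    col v x ≢ col x w → col v x ≢ col v w → col x w ≢ col v w → T (isRainbowApex v x w)
  rainbowApex-intro avw axw vx≢xw vx≢vw xw≢vw =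
    ∧-intro avw (∧-intro axw (∧-intro (≢⇒T-not-==ᶠ vx≢xw)
      (∧-intro (≢⇒T-not-==ᶠ vx≢vw) (≢⇒T-not-==ᶠ xw≢vw))))

  restricted⇒witness : ∀ {v X y α} → T (restricted G v X y α) →
    ∃ λ x → T (X x) × T (adj y x) × col x y ≡ α × col v x ≢ col x y
  restricted⇒witness {v} {X} {y} {α} r =
    let (x , witness)     = satisfied (any⁻ witnesses (allFin n) (proj₁ (∧-elim _ r)))
        (Xx , rest)       = ∧-elim (X x) witness
        (ayx , rest)      = ∧-elim (adj y x) rest
        (cxy≡α , rainbow) = ∧-elim (col x y ==ᶠ α) rest
    in x , Xx , ayx , toWitness cxy≡α , toWitnessFalse rainbow
    where
    witnesses : Fin n → Bool
    witnesses x = X x ∧ adj y x ∧ (col x y ==ᶠ α) ∧ not (col v x ==ᶠ col x y)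

  restricted⇒∉C : ∀ {v X y α z} → T (restricted G v X y α) →
                  T (adj y z) → ¬ T (X z) → col y z ≢ α
  restricted⇒∉C {X = X} {y} {α} {z} r ayz z∉X cyz≡α =
    T-not⇒¬T (proj₂ (∧-elim _ r)) (any⁺ _ (Any.map (λ { refl → z-witnesses }) (∈-allFin z)))
    where
    z-witnesses : T ((adj y z ∧ not (X z)) ∧ adj y z ∧ (col y z ==ᶠ α))
    z-witnesses = ∧-intro (∧-intro ayz (¬T⇒T-not z∉X)) (∧-intro ayz (fromWitness cyz≡α))

  restricted⇒rainbowApex : ∀ {v x β α} → T (adj v x) → col v x ≡ β →
    T (restricted G v (N∖Nc v β) x α) → ∃ λ w → T (isRainbowApex v x w) × col x w ≡ α
  restricted⇒rainbowApex {v} {x} {β} {α} avx cvx≡β r =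
    let (w , Yw , axw , cwx≡α , cvw≢cwx) = restricted⇒witness r
        (avw , cvw≢β)                   = ∧-elim (adj v w) Yw
        cxw≡α                           = trans (col-sym x w) cwx≡α
        cxv≢α                           = restricted⇒∉C r (subst T (adj-sym v x) avx) v∉Y
        apex = rainbowApex-intro avw axw
          (λ cvx≡cxw → cxv≢α (trans (col-sym x v) (trans cvx≡cxw cxw≡α)))
          (λ cvx≡cvw → toWitnessFalse cvw≢β (trans (sym cvx≡cvw) cvx≡β))
          (λ cxw≡cvw → cvw≢cwx (trans (sym cxw≡cvw) (col-sym x w)))
    in w , apex , cxw≡α
    where
    v∉Y : ¬ T (N∖Nc v β v)
    v∉Y v∈Y = subst T (adj-irr v) (proj₁ (∧-elim (adj v v) v∈Y))

  σ≤rt : ∀ {v x β} → T (adj v x) → col v x ≡ β → σ G v (N∖Nc v β) x ≤ rt G v x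
  σ≤rt {v} {x} avx cvx≡β =
    count-≤-image _ (isRainbowApex v x) (col x) (λ _ → restricted⇒rainbowApex avx cvx≡β)

proposition1 : ∀ {n k : ℕ} (G : ECGraph n k) (v x : Fin n) →
    ECGraph.adj G v x ≡ true →
    let Y = λ w → ECGraph.adj G v w ∧ not (ECGraph.col G v w ==ᶠ ECGraph.col G v x)
        Nα = Nc G v (ECGraph.col G v x)
    in (σ G v Y x ≤ rt G v x)
       × (sumOver Nα (σ G v Y) ≤ rtSet G v Nα)
proposition1 G v x avx≡true =
  σ≤rt G (Equivalence.from T-≡ avx≡true) refl ,
  sumOver-mono (Nc G v (col v x)) λ x′ x′∈Nα →
    let (avx′ , cvx′≡cvx) = ∧-elim (adj v x′) x′∈Nα
    in σ≤rt G avx′ (toWitness cvx′≡cvx)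
  where open ECGraph G
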